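{- Let $G$ be a finite simple graph and $r\ge1$ an integer. Then at least one of the following holds: (1) $\chi_r(G)-M_r(G)\le\frac{\omega(G)+\Delta(G)+1}{2}$; (2) $\chi_r(G)-M_r(G)\le\frac{\frac{\omega(G)}{2}+|G|-rM_r(G)}{2}$.
   Context: An $r$-bounded coloring of $G$ is a proper coloring in which every color class has at most $r$ vertices. $\chi_r(G)$ is the minimum number of color classes in an $r$-bounded coloring of $G$ (such a coloring is an optimal $r$-bounded coloring). $M_r(G)$ is the maximum, over all optimal $r$-bounded colorings, of the number of color classes of size exactly $r$. $\omega(G)$, $\Delta(G)$, $|G|$ are the clique number, maximum degree and number of vertices. -}

module Defs where

open import Data.Nat using (ℕ; zero; suc; _+_; _*_; _∸_; _≤_; _<_; _⊔_)
open import Data.Fin using (Fin)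
open import Data.Fin.Properties using (_≟_)
open import Data.Fin.Subset using (Subset; _∈_; ∣_∣)
open import Data.Vec using (tabulate; foldr)
open import Data.Product using (Σ; _×_; _,_)
open import Relation.Nullary using (¬_; Dec)
open import Relation.Nullary.Decidable using (⌊_⌋)
open import Relation.Binary.PropositionalEquality using (_≡_; _≢_)

record Graph (n : ℕ) : Set₁ where
  field
    Adj     : Fin n → Fin n → Set
    adj?    : ∀ u v → Dec (Adj u v)
    sym     : ∀ {u v} → Adj u v → Adj v u
    irrefl  : ∀ {u} → ¬ Adj u u

open Graph public

order : ∀ {n} → Graph n → ℕ
order {n} _ = n

nbhd : ∀ {n} → Graph n → Fin n → Subset n
nbhd G v = tabulate (λ u → ⌊ adj? G v u ⌋)

degree : ∀ {n} → Graph n → Fin n → ℕ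
degree G v = ∣ nbhd G v ∣

maxDegree : ∀ {n} → Graph n → ℕ
maxDegree G = foldr _ _⊔_ 0 (tabulate (degree G))

IsClique : ∀ {n} → Graph n → Subset n → Set
IsClique G S = ∀ u v → u ∈ S → v ∈ S → u ≢ v → Adj G u v

IsCliqueNumber : ∀ {n} → Graph n → ℕ → Set
IsCliqueNumber G w =
  Σ _ (λ S → IsClique G S × ∣ S ∣ ≡ w) × (∀ S → IsClique G S → ∣ S ∣ ≤ w)

colourClass : ∀ {n k} → (Fin n → Fin k) → Fin k → Subset n
colourClass c i = tabulate (λ v → ⌊ c v ≟ i ⌋)

IsProper : ∀ {n k} → Graph n → (Fin n → Fin k) → Set
IsProper G c = ∀ u v → Adj G u v → c u ≢ c v

IsBoundedColouring : ∀ {n k} → Graph n → ℕ → (Fin n → Fin k) → Set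
IsBoundedColouring {k = k} G r c = IsProper G c × (∀ i → ∣ colourClass c i ∣ ≤ r)

IsChiR : ∀ {n} → Graph n → ℕ → ℕ → Set
IsChiR G r x =
  Σ (Fin _ → Fin x) (IsBoundedColouring G r)
  × (∀ k → k < x → ¬ Σ (Fin _ → Fin k) (IsBoundedColouring G r))

fullClasses : ∀ {n k} → (Fin n → Fin k) → ℕ → ℕ
fullClasses {k = k} c r = ∣ tabulate (λ i → ⌊ ∣ colourClass c i ∣ Data.Nat.≟ r ⌋) ∣
  where import Data.Nat

IsMR : ∀ {n} → Graph n → ℕ → ℕ → ℕ → Set
IsMR {n} G r x m =
  Σ (Fin n → Fin x) (λ c → IsBoundedColouring G r c × fullClasses c r ≡ m)
  × (∀ (c : Fin n → Fin x) → IsBoundedColouring G r c → fullClasses c r ≤ m)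

-- Fix an optimal r-bounded colouring with m full classes and call the other classes singletons
-- (s of them) and partial classes (at least two vertices; t of them), so that x − m = s + t and
-- |G| − r m ≥ s + 2t.  Optimality forbids merging two classes that have no edges between them and
-- together have at most r vertices.  Hence the singleton vertices form a clique, and a singleton
-- vertex v has a neighbour in every other non-full class, and at least two in every partial class
-- except the j(v) classes where its neighbour is unique; so s + 2t ≤ deg v + 1 + j(v).  If b is
-- the unique neighbour of v in a partial class, exchanging the colours of v and b gives another
-- optimal colouring in which b is a singleton.  If both inequalities fail, then 2s > ω and
-- j(v) ≥ ω + 1 − s for every singleton v, so ω + 1 − s singleton vertices can be greedily matched
-- to distinct partial classes through unique neighbours b; exchanging (once or twice) shows these
-- b are adjacent to each other and to every singleton vertex, which yields a clique of size ω + 1.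

module Submission where

open import Defs renaming (sym to Adj-sym)
open import Data.Nat using (ℕ; zero; suc; _+_; _*_; _∸_; _≤_; _<_; _⊔_; _≤?_; z≤n; s≤s)
  renaming (_≟_ to _≟ⁿ_)
open import Data.Nat.Properties
open import Data.Nat.Tactic.RingSolver using (solve-∀)
open import Data.Bool using (if_then_else_)
open import Data.Fin using (Fin; zero; suc; punchIn; punchOut)
open import Data.Fin.Properties using (any?; punchIn-punchOut; punchIn-injective) renaming (_≟_ to _≟ᶠ_)
open import Data.Fin.Subset using (_∈_; ∣_∣)
open import Data.Fin.Permutation using (Permutation; _⟨$⟩ʳ_) renaming (transpose to transposeₚ)
open import Data.Fin.Permutation.Components using (transpose)
open import Data.Vec using (tabulate; foldr; here; there)
open import Data.Vec.Functional using (_∷_)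
open import Data.Product using (Σ; ∃; _×_; _,_; proj₁; proj₂)
open import Data.Sum using (_⊎_; inj₁; inj₂)
import Data.Sum as Sum
open import Data.Unit using (tt)
open import Function using (_∘_; id)
open import Function.Definitions using (Injective)
open import Level using (0ℓ)
open import Relation.Nullary using (¬_; Dec; does; yes; no; contradiction; ¬?)
open import Relation.Nullary.Decidable using (⌊_⌋; _×-dec_; _⊎-dec_; dec-true; dec-false)
open import Relation.Unary using (Pred; Decidable; _⊆_)
open import Relation.Binary.PropositionalEquality
open import Algebra.Properties.Semiring.Sum +-*-semiring
  using (sum; sum-cong-≗; ∑-distrib-+; ∑-comm; sum-permute; *-distribˡ-sum)

private variable
  n : ℕ

-- Through `does` only, so that it computes on `_×-dec_`, `_⊎-dec_` and `map′` without their proofs.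
indicator : ∀ {a} {A : Set a} → Dec A → ℕ
indicator a? = if does a? then 1 else 0

count : {P : Pred (Fin n) 0ℓ} → Decidable P → ℕ
count P? = sum (λ u → indicator (P? u))

module _ {a b} {A : Set a} {B : Set b} where

  indicator-mono : (A → B) → (a? : Dec A) (b? : Dec B) → indicator a? ≤ indicator b?
  indicator-mono f (no _) _ = z≤n
  indicator-mono f (yes a) (yes _) = ≤-refl
  indicator-mono f (yes a) (no ¬b) = contradiction (f a) ¬b

  indicator-∪ : (a? : Dec A) (b? : Dec B) →
    indicator (a? ⊎-dec b?) + indicator (a? ×-dec b?) ≡ indicator a? + indicator b?
  indicator-∪ (yes _) (yes _) = refl
  indicator-∪ (yes _) (no _) = refl
  indicator-∪ (no _) (yes _) = refl
  indicator-∪ (no _) (no _) = refl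

∣tabulate∣≡count : {P : Pred (Fin n) 0ℓ} (P? : Decidable P) →
  ∣ tabulate (λ u → ⌊ P? u ⌋) ∣ ≡ count P?
∣tabulate∣≡count {zero} P? = refl
∣tabulate∣≡count {suc n} P? with P? zero
... | yes _ = cong suc (∣tabulate∣≡count (P? ∘ suc))
... | no _ = ∣tabulate∣≡count (P? ∘ suc)

sum-mono : {f g : Fin n → ℕ} → (∀ u → f u ≤ g u) → sum f ≤ sum g
sum-mono {zero} f≤g = z≤n
sum-mono {suc n} f≤g = +-mono-≤ (f≤g zero) (sum-mono (f≤g ∘ suc))

count-mono : {P Q : Pred (Fin n) 0ℓ} → (P? : Decidable P) (Q? : Decidable Q) →
  P ⊆ Q → count P? ≤ count Q?
count-mono P? Q? P⊆Q = sum-mono (λ u → indicator-mono P⊆Q (P? u) (Q? u))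

count-cong : {P Q : Pred (Fin n) 0ℓ} → (P? : Decidable P) (Q? : Decidable Q) →
  P ⊆ Q → Q ⊆ P → count P? ≡ count Q?
count-cong P? Q? P⊆Q Q⊆P = ≤-antisym (count-mono P? Q? P⊆Q) (count-mono Q? P? Q⊆P)

count-∪ : {P Q : Pred (Fin n) 0ℓ} → (P? : Decidable P) (Q? : Decidable Q) →
  count (λ u → P? u ⊎-dec Q? u) + count (λ u → P? u ×-dec Q? u) ≡ count P? + count Q?
count-∪ P? Q? = begin
  count (λ u → P? u ⊎-dec Q? u) + count (λ u → P? u ×-dec Q? u)
    ≡⟨ ∑-distrib-+ (λ u → indicator (P? u ⊎-dec Q? u)) _ ⟨
  sum (λ u → indicator (P? u ⊎-dec Q? u) + indicator (P? u ×-dec Q? u))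
    ≡⟨ sum-cong-≗ (λ u → indicator-∪ (P? u) (Q? u)) ⟩
  sum (λ u → indicator (P? u) + indicator (Q? u))
    ≡⟨ ∑-distrib-+ (λ u → indicator (P? u)) _ ⟩
  count P? + count Q? ∎
  where open ≡-Reasoning

∉⇒count≡0 : {P : Pred (Fin n) 0ℓ} → (P? : Decidable P) → (∀ u → ¬ P u) → count P? ≡ 0
∉⇒count≡0 {zero} P? ¬P = refl
∉⇒count≡0 {suc n} P? ¬P with P? zero
... | yes p = contradiction p (¬P zero)
... | no _ = ∉⇒count≡0 (P? ∘ suc) (¬P ∘ suc)

count-all : (n : ℕ) → count {n} (λ _ → yes tt) ≡ n
count-all zero = refl
count-all (suc n) = cong suc (count-all n)

count-≟≡1 : (a : Fin n) → count (a ≟ᶠ_) ≡ 1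
count-≟≡1 {suc n} zero = cong suc (∉⇒count≡0 (λ (u : Fin n) → zero ≟ᶠ suc u) (λ _ ()))
count-≟≡1 {suc n} (suc a) = count-≟≡1 a

witness⇒count>0 : {P : Pred (Fin n) 0ℓ} → (P? : Decidable P) → ∀ {u} → P u → 0 < count P?
witness⇒count>0 P? {u} Pu =
  subst (_≤ count P?) (count-≟≡1 u) (count-mono (u ≟ᶠ_) P? (λ { refl → Pu }))

count>0⇒witness : {P : Pred (Fin n) 0ℓ} → (P? : Decidable P) → 0 < count P? → ∃ P
count>0⇒witness {suc n} P? pos with P? zero
... | yes p = zero , p
... | no _ with count>0⇒witness (P? ∘ suc) pos
...   | u , p = suc u , p

count≡0⇒∉ : {P : Pred (Fin n) 0ℓ} → (P? : Decidable P) → count P? ≡ 0 → ∀ u → ¬ P u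
count≡0⇒∉ P? count≡0 u Pu = <-irrefl (sym count≡0) (witness⇒count>0 P? Pu)

two-witnesses⇒count≥2 : {P : Pred (Fin n) 0ℓ} (P? : Decidable P) → ∀ {u v} →
  u ≢ v → P u → P v → 2 ≤ count P?
two-witnesses⇒count≥2 P? {zero} {zero} u≢v _ _ = contradiction refl u≢v
two-witnesses⇒count≥2 P? {zero} {suc v} _ Pu Pv with P? zero
... | yes _ = s≤s (witness⇒count>0 (P? ∘ suc) Pv)
... | no ¬Pu = contradiction Pu ¬Pu
two-witnesses⇒count≥2 P? {suc u} {zero} _ Pu Pv with P? zero
... | yes _ = s≤s (witness⇒count>0 (P? ∘ suc) Pu)
... | no ¬Pv = contradiction Pv ¬Pv
two-witnesses⇒count≥2 P? {suc u} {suc v} u≢v Pu Pv =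
  ≤-trans (two-witnesses⇒count≥2 (P? ∘ suc) (u≢v ∘ cong suc) Pu Pv) (m≤n+m _ (indicator (P? zero)))

count≡1⇒unique : {P : Pred (Fin n) 0ℓ} → (P? : Decidable P) → count P? ≡ 1 →
  ∀ {u v} → P u → P v → u ≡ v
count≡1⇒unique P? count≡1 {u} {v} Pu Pv with u ≟ᶠ v
... | yes u≡v = u≡v
... | no u≢v = contradiction (subst (2 ≤_) count≡1 (two-witnesses⇒count≥2 P? u≢v Pu Pv)) λ { (s≤s ()) }

unique⇒count≡1 : {P : Pred (Fin n) 0ℓ} → (P? : Decidable P) → ∀ {p} → P p →
  (∀ {u} → P u → u ≡ p) → count P? ≡ 1
unique⇒count≡1 P? {p} Pp unique =
  trans (count-cong P? (p ≟ᶠ_) (sym ∘ unique) (λ { refl → Pp })) (count-≟≡1 p)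

count-partition : ∀ {k} {P : Pred (Fin n) 0ℓ} (P? : Decidable P) (c : Fin n → Fin k) →
  count P? ≡ sum (λ i → count (λ u → P? u ×-dec c u ≟ᶠ i))
count-partition P? c = begin
  count P?
    ≡⟨ sum-cong-≗ split ⟩
  sum (λ u → sum (λ i → indicator (P? u ×-dec c u ≟ᶠ i)))
    ≡⟨ ∑-comm (λ u i → indicator (P? u ×-dec c u ≟ᶠ i)) ⟩
  sum (λ i → count (λ u → P? u ×-dec c u ≟ᶠ i)) ∎
  where
  open ≡-Reasoning
  split : ∀ u → indicator (P? u) ≡ count (λ i → P? u ×-dec c u ≟ᶠ i)
  split u with P? u
  ... | yes _ = sym (count-≟≡1 (c u))
  ... | no ¬Pu = sym (∉⇒count≡0 (λ i → no ¬Pu ×-dec c u ≟ᶠ i) (λ _ → ¬Pu ∘ proj₁))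

∑-fibres : ∀ {k} (c : Fin n → Fin k) → sum (λ i → count (λ u → c u ≟ᶠ i)) ≡ n
∑-fibres {n} c = trans (sym (count-partition (λ _ → yes tt) c)) (count-all n)

count-permute : {P : Pred (Fin n) 0ℓ} → (P? : Decidable P) (π : Permutation n n) →
  count (P? ∘ (π ⟨$⟩ʳ_)) ≡ count P?
count-permute P? π = sym (sum-permute (indicator ∘ P?) π)

image? : ∀ {m} (f : Fin m → Fin n) → Decidable (λ u → ∃ λ k → f k ≡ u)
image? f u = any? (λ k → f k ≟ᶠ u)

count-image≤ : ∀ {m} (f : Fin m → Fin n) → count (image? f) ≤ m
count-image≤ {m = m} f = begin
  count (image? f)                        ≤⟨ sum-mono image≤fibre ⟩
  sum (λ u → count (λ k → f k ≟ᶠ u))      ≡⟨ ∑-fibres f ⟩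
  m                                       ∎
  where
  open ≤-Reasoning
  image≤fibre : ∀ u → indicator (image? f u) ≤ count (λ k → f k ≟ᶠ u)
  image≤fibre u with image? f u
  ... | yes (k , fk≡u) = witness⇒count>0 (λ k → f k ≟ᶠ u) fk≡u
  ... | no _ = z≤n

injective⇒count-image≥ : ∀ {m} (f : Fin m → Fin n) → Injective _≡_ _≡_ f → m ≤ count (image? f)
injective⇒count-image≥ {m = m} f f-inj = begin
  m                                       ≡⟨ ∑-fibres f ⟨
  sum (λ u → count (λ k → f k ≟ᶠ u))      ≤⟨ sum-mono fibre≤image ⟩
  count (image? f)                        ∎
  where
  open ≤-Reasoning
  fibre≤image : ∀ u → count (λ k → f k ≟ᶠ u) ≤ indicator (image? f u)
  fibre≤image u with image? f u
  ... | yes (k , refl) = ≤-reflexive (unique⇒count≡1 (λ j → f j ≟ᶠ f k) refl f-inj)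
  ... | no ∉image = ≤-reflexive (∉⇒count≡0 (λ k → f k ≟ᶠ u) (λ k fk≡u → ∉image (k , fk≡u)))

outside-image : ∀ {m} {P : Pred (Fin n) 0ℓ} (P? : Decidable P) (f : Fin m → Fin n) →
  m < count P? → ∃ λ y → P y × ∀ k → f k ≢ y
outside-image {P = P} P? f m<count with any? (λ y → P? y ×-dec ¬? (image? f y))
... | yes (y , Py , ∉image) = y , Py , λ k fk≡y → ∉image (k , fk≡y)
... | no none =
  contradiction (≤-trans (count-mono P? (image? f) P⊆image) (count-image≤ f)) (<⇒≱ m<count)
  where
  P⊆image : ∀ {y} → P y → ∃ λ k → f k ≡ y
  P⊆image {y} Py with image? f y
  ... | yes k = k
  ... | no ∉image = contradiction (y , Py , ∉image) none

module _ {n : ℕ} where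

  transpose-matchˡ : (i j : Fin n) → transpose i j i ≡ j
  transpose-matchˡ i j rewrite dec-true (i ≟ᶠ i) refl = refl

  transpose-other : ∀ {i j k : Fin n} → k ≢ i → k ≢ j → transpose i j k ≡ k
  transpose-other {i} {j} {k} k≢i k≢j rewrite dec-false (k ≟ᶠ i) k≢i | dec-false (k ≟ᶠ j) k≢j = refl

  transpose-matchʳ : (i j : Fin n) → transpose i j j ≡ i
  transpose-matchʳ i j = by-cases (j ≟ᶠ i)
    where
    by-cases : ∀ {i j} → Dec (j ≡ i) → transpose i j j ≡ i
    by-cases {i} (yes refl) = transpose-matchˡ i i
    by-cases {i} {j} (no j≢i) rewrite dec-false (j ≟ᶠ i) j≢i | dec-true (j ≟ᶠ j) refl = refl

  data Transposed (i j : Fin n) : Fin n → Fin n → Set where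
    at-i      : Transposed i j i j
    at-j      : Transposed i j j i
    elsewhere : ∀ {k} → k ≢ i → k ≢ j → Transposed i j k k

  transposed : (i j k : Fin n) → Transposed i j k (transpose i j k)
  transposed i j k = by-cases (k ≟ᶠ i) (k ≟ᶠ j)
    where
    by-cases : ∀ {i j k} → Dec (k ≡ i) → Dec (k ≡ j) → Transposed i j k (transpose i j k)
    by-cases {i} {j} (yes refl) _ = subst (Transposed i j i) (sym (transpose-matchˡ i j)) at-i
    by-cases {i} {j} (no _) (yes refl) = subst (Transposed i j j) (sym (transpose-matchʳ i j)) at-j
    by-cases {i} {j} {k} (no k≢i) (no k≢j) =
      subst (Transposed i j k) (sym (transpose-other k≢i k≢j)) (elsewhere k≢i k≢j)

  transpose-involutive : (i j k : Fin n) → transpose i j (transpose i j k) ≡ k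
  transpose-involutive i j k with transpose i j k | transposed i j k
  ... | _ | at-i              = transpose-matchʳ i j
  ... | _ | at-j              = transpose-matchˡ i j
  ... | _ | elsewhere k≢i k≢j = transpose-other k≢i k≢j

∈-tabulate⁻ : {P : Pred (Fin n) 0ℓ} (P? : Decidable P) → ∀ {u} → u ∈ tabulate (λ v → ⌊ P? v ⌋) → P u
∈-tabulate⁻ P? {zero} u∈ with P? zero | u∈
... | yes Pu | _ = Pu
... | no _ | ()
∈-tabulate⁻ P? {suc u} (there u∈) = ∈-tabulate⁻ (P? ∘ suc) u∈

≤-foldr-⊔ : (f : Fin n → ℕ) (u : Fin n) → f u ≤ foldr _ _⊔_ 0 (tabulate f)
≤-foldr-⊔ f zero = m≤m⊔n _ _
≤-foldr-⊔ f (suc u) = ≤-trans (≤-foldr-⊔ (f ∘ suc) u) (m≤n⊔m (f zero) _)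

∷-injective : ∀ {q} {A B : Set} (g : A → B) {a : A} {f : Fin q → A} →
  (∀ k → g (f k) ≢ g a) → Injective _≡_ _≡_ (g ∘ f) → Injective _≡_ _≡_ (g ∘ (a ∷ f))
∷-injective g new f-inj {zero} {zero} _ = refl
∷-injective g new f-inj {zero} {suc j} ga≡gfj = contradiction (sym ga≡gfj) (new j)
∷-injective g new f-inj {suc i} {zero} gfi≡ga = contradiction gfi≡ga (new i)
∷-injective g new f-inj {suc i} {suc j} gfi≡gfj = cong suc (f-inj gfi≡gfj)

degree≡count : (G : Graph n) (v : Fin n) → degree G v ≡ count (adj? G v)
degree≡count G v = ∣tabulate∣≡count (adj? G v)

degree≤maxDegree : (G : Graph n) (v : Fin n) → degree G v ≤ maxDegree G
degree≤maxDegree G = ≤-foldr-⊔ (degree G)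

m<2n⇒1+m∸n≤n : ∀ m n → m < 2 * n → suc m ∸ n ≤ n
m<2n⇒1+m∸n≤n m n m<2n = m≤n+o⇒m∸n≤o (suc m) n (subst (suc m ≤_) (cong (n +_) (+-identityʳ n)) m<2n)

-- The sum of the two hypotheses, with the common summand s + 2t + Δ + 1 cancelled.
<-add-cancel : ∀ w Δ s t j → w + Δ + 1 < 2 * (s + t) → s + 2 * t ≤ Δ + 1 + j → w < s + j
<-add-cancel w Δ s t j lt le = +-cancelʳ-≤ (s + 2 * t + Δ + 1) (suc w) (s + j) added
  where
  lhs : ∀ w Δ s t → suc (w + Δ + 1) + (s + 2 * t) ≡ suc w + (s + 2 * t + Δ + 1)
  lhs = solve-∀
  rhs : ∀ Δ s t j → 2 * (s + t) + (Δ + 1 + j) ≡ s + j + (s + 2 * t + Δ + 1)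
  rhs = solve-∀
  added : suc w + (s + 2 * t + Δ + 1) ≤ s + j + (s + 2 * t + Δ + 1)
  added = subst₂ _≤_ (lhs w Δ s t) (rhs Δ s t j) (+-mono-≤ lt le)

module ClassKinds (r : ℕ) where

  IsFull IsSingleton IsPartial : ℕ → Set
  IsFull k      = k ≡ r
  IsSingleton k = k ≢ r × k ≡ 1
  IsPartial k   = k ≢ r × 2 ≤ k

  full? : Decidable IsFull
  full? k = k ≟ r

  singleton? : Decidable IsSingleton
  singleton? k = ¬? (k ≟ r) ×-dec k ≟ 1

  partial? : Decidable IsPartial
  partial? k = ¬? (k ≟ r) ×-dec 2 ≤? k

  ¬singleton×partial : ∀ {k} → IsSingleton k → ¬ IsPartial k
  ¬singleton×partial (_ , refl) (_ , s≤s ())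

  kinds-partition : ∀ {k} → 0 < k → indicator (full? k) + indicator (singleton? k) + indicator (partial? k) ≡ 1
  kinds-partition {k} 0<k = by-cases (k ≟ r) (k ≟ 1) (2 ≤? k)
    -- The decisions are arguments rather than `with`-abstractions: once unfolded, `_≟_` on ℕ
    -- computes to `_≡ᵇ_`, which `with` can no longer find in the goal.
    where
    by-cases : (f? : Dec (k ≡ r)) (s? : Dec (k ≡ 1)) (p? : Dec (2 ≤ k)) →
      indicator f? + indicator (¬? f? ×-dec s?) + indicator (¬? f? ×-dec p?) ≡ 1
    by-cases (yes _) _ _ = refl
    by-cases (no _) (yes refl) (no _) = refl
    by-cases (no _) (yes refl) (yes (s≤s ()))
    by-cases (no _) (no _) (yes _) = refl
    by-cases (no _) (no k≢1) (no 2≰k) = contradiction (≤∧≢⇒< 0<k (k≢1 ∘ sym)) 2≰k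

  kinds-weight : ∀ k → r * indicator (full? k) + indicator (singleton? k) + 2 * indicator (partial? k) ≤ k
  kinds-weight k = by-cases (k ≟ r) (k ≟ 1) (2 ≤? k)
    where
    by-cases : (f? : Dec (k ≡ r)) (s? : Dec (k ≡ 1)) (p? : Dec (2 ≤ k)) →
      r * indicator f? + indicator (¬? f? ×-dec s?) + 2 * indicator (¬? f? ×-dec p?) ≤ k
    by-cases (yes refl) _ _ rewrite *-identityʳ k | +-identityʳ k | +-identityʳ k = ≤-refl
    by-cases (no _) (yes refl) (no _) rewrite *-zeroʳ r = ≤-refl
    by-cases (no _) (yes refl) (yes (s≤s ()))
    by-cases (no _) (no _) (yes 2≤k) rewrite *-zeroʳ r = 2≤k
    by-cases (no _) (no _) (no _) rewrite *-zeroʳ r = z≤n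

  module _ {x} (k : Fin x → ℕ) where

    private
      ind-full ind-sing ind-part : Fin x → ℕ
      ind-full = indicator ∘ full? ∘ k
      ind-sing = indicator ∘ singleton? ∘ k
      ind-part = indicator ∘ partial? ∘ k

    full singletons partials : ℕ
    full       = count (full? ∘ k)
    singletons = count (singleton? ∘ k)
    partials   = count (partial? ∘ k)

    count-kinds : (∀ i → 0 < k i) → x ≡ full + singletons + partials
    count-kinds k>0 = begin
      x                                               ≡⟨ count-all x ⟨
      sum {x} (λ _ → 1)                               ≡⟨ sum-cong-≗ (sym ∘ kinds-partition ∘ k>0) ⟩
      sum (λ i → ind-full i + ind-sing i + ind-part i)
                                                      ≡⟨ ∑-distrib-+ (λ i → ind-full i + ind-sing i) ind-part ⟩
      sum (λ i → ind-full i + ind-sing i) + partials  ≡⟨ cong (_+ partials) (∑-distrib-+ ind-full ind-sing) ⟩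
      full + singletons + partials                    ∎
      where open ≡-Reasoning

    weighted-count≤sum : r * full + singletons + 2 * partials ≤ sum k
    weighted-count≤sum = begin
      r * full + singletons + 2 * partials
        ≡⟨ cong₂ (λ a b → a + singletons + b) (*-distribˡ-sum r ind-full) (*-distribˡ-sum 2 ind-part) ⟩
      sum (λ i → r * ind-full i) + singletons + sum (λ i → 2 * ind-part i)
        ≡⟨ cong (_+ sum (λ i → 2 * ind-part i)) (∑-distrib-+ (λ i → r * ind-full i) ind-sing) ⟨
      sum (λ i → r * ind-full i + ind-sing i) + sum (λ i → 2 * ind-part i)
        ≡⟨ ∑-distrib-+ (λ i → r * ind-full i + ind-sing i) (λ i → 2 * ind-part i) ⟨
      sum (λ i → r * ind-full i + ind-sing i + 2 * ind-part i)
        ≤⟨ sum-mono (kinds-weight ∘ k) ⟩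
      sum k ∎
      where open ≤-Reasoning

module BoundedColourings {n : ℕ} (G : Graph n) (r : ℕ) where

  inClass : ∀ {x} (c : Fin n → Fin x) (i : Fin x) → Decidable (λ u → c u ≡ i)
  inClass c i u = c u ≟ᶠ i

  classSize : ∀ {x} → (Fin n → Fin x) → Fin x → ℕ
  classSize c i = count (inClass c i)

  Bounded : ∀ {x} → (Fin n → Fin x) → Set
  Bounded = IsBoundedColouring G r

  NoSmallerColouring : ℕ → Set
  NoSmallerColouring x = ∀ k → k < x → ¬ Σ (Fin n → Fin k) Bounded

  module _ {x} {c : Fin n → Fin x} where

    classSize≤r : Bounded c → ∀ i → classSize c i ≤ r
    classSize≤r (_ , bounded) i = subst (_≤ r) (∣tabulate∣≡count (inClass c i)) (bounded i)

    bounded : IsProper G c → (∀ i → classSize c i ≤ r) → Bounded c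
    bounded proper size≤r = proper , λ i → subst (_≤ r) (sym (∣tabulate∣≡count (inClass c i))) (size≤r i)

  drop-unused-colour : ∀ {k} (c : Fin n → Fin (suc k)) → Bounded c →
    (j : Fin (suc k)) → (∀ u → c u ≢ j) → Σ (Fin n → Fin k) Bounded
  drop-unused-colour c c-bounded j unused = c′ , bounded proper′ size≤r
    where
    c′ = λ u → punchOut (unused u ∘ sym)
    punchIn-c′ : ∀ u → punchIn j (c′ u) ≡ c u
    punchIn-c′ u = punchIn-punchOut (unused u ∘ sym)
    proper′ : IsProper G c′
    proper′ u w u~w c′u≡c′w = proj₁ c-bounded u w u~w
      (trans (sym (punchIn-c′ u)) (trans (cong (punchIn j) c′u≡c′w) (punchIn-c′ w)))
    same-class : ∀ l → classSize c′ l ≡ classSize c (punchIn j l)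
    same-class l = count-cong (inClass c′ l) (inClass c (punchIn j l))
      (λ {u} c′u≡l → trans (sym (punchIn-c′ u)) (cong (punchIn j) c′u≡l))
      (λ {u} cu≡l → punchIn-injective j _ _ (trans (punchIn-c′ u) cu≡l))
    size≤r : ∀ l → classSize c′ l ≤ r
    size≤r l = subst (_≤ r) (sym (same-class l)) (classSize≤r c-bounded (punchIn j l))

  ¬unused-colour : ∀ {x} → NoSmallerColouring x → (c : Fin n → Fin x) → Bounded c →
    (j : Fin x) → ¬ (∀ u → c u ≢ j)
  ¬unused-colour {suc k} optimal c c-bounded j unused =
    optimal k ≤-refl (drop-unused-colour c c-bounded j unused)

  Mergeable : ∀ {x} → (Fin n → Fin x) → Fin x → Fin x → Set
  Mergeable c i j = i ≢ j × classSize c i + classSize c j ≤ r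
                    × (∀ u w → c u ≡ i → c w ≡ j → ¬ Adj G u w)

  merge : ∀ {x} → Fin x → Fin x → Fin x → Fin x
  merge i j a = if does (a ≟ᶠ j) then i else a

  data MergeView {x} (i j a : Fin x) : Fin x → Set where
    merged : a ≡ j → MergeView i j a i
    kept   : a ≢ j → MergeView i j a a

  merge-view : ∀ {x} (i j a : Fin x) → MergeView i j a (merge i j a)
  merge-view i j a with a ≟ᶠ j
  ... | yes a≡j = merged a≡j
  ... | no a≢j = kept a≢j

  merge≡i : ∀ {x} (i j a : Fin x) → merge i j a ≡ i → a ≡ i ⊎ a ≡ j
  merge≡i i j a with merge i j a | merge-view i j a
  ... | _ | merged a≡j = λ _ → inj₂ a≡j
  ... | _ | kept _     = inj₁

  merge≡other : ∀ {x} (i j a : Fin x) {l} → l ≢ i → merge i j a ≡ l → a ≡ l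
  merge≡other i j a l≢i with merge i j a | merge-view i j a
  ... | _ | merged _ = λ i≡l → contradiction (sym i≡l) l≢i
  ... | _ | kept _   = λ a≡l → a≡l

  merge≢j : ∀ {x} {i j : Fin x} a → i ≢ j → merge i j a ≢ j
  merge≢j {i = i} {j} a i≢j with merge i j a | merge-view i j a
  ... | _ | merged _ = i≢j
  ... | _ | kept a≢j = a≢j

  merge-bounded : ∀ {x} {c : Fin n → Fin x} {i j} → Bounded c → Mergeable c i j → Bounded (merge i j ∘ c)
  merge-bounded {c = c} {i} {j} c-bounded (i≢j , sizes≤r , no-edges) = bounded proper′ size≤r
    where
    proper : IsProper G c
    proper = proj₁ c-bounded
    proper′ : IsProper G (merge i j ∘ c)
    proper′ u w u~w with merge i j (c u) | merge-view i j (c u) | merge i j (c w) | merge-view i j (c w)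
    ... | _ | merged cu≡j | _ | merged cw≡j = λ _ → proper u w u~w (trans cu≡j (sym cw≡j))
    ... | _ | merged cu≡j | _ | kept _      = λ i≡cw → no-edges w u (sym i≡cw) cu≡j (Adj-sym G u~w)
    ... | _ | kept _      | _ | merged cw≡j = λ cu≡i → no-edges u w cu≡i cw≡j u~w
    ... | _ | kept _      | _ | kept _      = proper u w u~w
    size≤r : ∀ l → classSize (merge i j ∘ c) l ≤ r
    size≤r l with l ≟ᶠ i
    ... | yes refl = begin
      classSize (merge i j ∘ c) i       ≤⟨ count-mono (inClass (merge i j ∘ c) i) i∪j? (merge≡i i j _) ⟩
      count i∪j?                        ≤⟨ m≤m+n _ _ ⟩
      count i∪j? + count (λ u → inClass c i u ×-dec inClass c j u)
                                        ≡⟨ count-∪ (inClass c i) (inClass c j) ⟩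
      classSize c i + classSize c j     ≤⟨ sizes≤r ⟩
      r                                 ∎
      where
      open ≤-Reasoning
      i∪j? = λ u → inClass c i u ⊎-dec inClass c j u
    ... | no l≢i = ≤-trans (count-mono (inClass (merge i j ∘ c) l) (inClass c l) (merge≡other i j _ l≢i))
                     (classSize≤r c-bounded l)

  SingletonClass : ∀ {x} → (Fin n → Fin x) → Fin x → Fin n → Set
  SingletonClass c a p = c p ≡ a × (∀ {u} → c u ≡ a → u ≡ p)

  SingletonClass-transpose : ∀ {x} {c : Fin n → Fin x} {a p} (v b : Fin n) →
    SingletonClass c a p → SingletonClass (c ∘ transpose v b) a (transpose v b p)
  SingletonClass-transpose {c = c} v b (cp≡a , unique) =
    trans (cong c (transpose-involutive v b _)) cp≡a ,
    λ {u} cτu≡a → trans (sym (transpose-involutive v b u)) (cong (transpose v b) (unique cτu≡a))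

  record Swappable {x} (c : Fin n → Fin x) (v b : Fin n) : Set where
    field
      alone         : SingletonClass c (c v) v
      only-neighbour    : ∀ {u} → c u ≡ c b → Adj G v u → u ≡ b
      colours-differ : c v ≢ c b

  module _ {x} {c : Fin n → Fin x} {v b : Fin n} (swappable : Swappable c v b) where
    open Swappable swappable

    swap-bounded : Bounded c → Bounded (c ∘ transpose v b)
    swap-bounded c-bounded = bounded proper′ size≤r
      where
      proper : IsProper G c
      proper = proj₁ c-bounded
      proper′ : IsProper G (c ∘ transpose v b)
      proper′ u w u~w with transpose v b u | transposed v b u | transpose v b w | transposed v b w
      ... | _ | at-i | _ | at-i = contradiction u~w (irrefl G)
      ... | _ | at-i | _ | at-j = colours-differ ∘ sym
      ... | _ | at-i | _ | elsewhere _ w≢b = λ cb≡cw → w≢b (only-neighbour (sym cb≡cw) u~w)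
      ... | _ | at-j | _ | at-i = colours-differ
      ... | _ | at-j | _ | at-j = contradiction u~w (irrefl G)
      ... | _ | at-j | _ | elsewhere w≢v _ = λ cv≡cw → w≢v (proj₂ alone (sym cv≡cw))
      ... | _ | elsewhere _ u≢b | _ | at-i = λ cu≡cb → u≢b (only-neighbour cu≡cb (Adj-sym G u~w))
      ... | _ | elsewhere u≢v _ | _ | at-j = λ cu≡cv → u≢v (proj₂ alone cu≡cv)
      ... | _ | elsewhere _ _ | _ | elsewhere _ _ = proper u w u~w
      size≤r : ∀ l → classSize (c ∘ transpose v b) l ≤ r
      size≤r l = subst (_≤ r) (sym (count-permute (inClass c l) (transposeₚ v b))) (classSize≤r c-bounded l)

    swap-alone : SingletonClass (c ∘ transpose v b) (c v) b
    swap-alone = subst (SingletonClass (c ∘ transpose v b) (c v)) (transpose-matchˡ v b)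
                   (SingletonClass-transpose v b alone)

    swap-keeps-SingletonClass : ∀ {a p} → p ≢ v → p ≢ b →
      SingletonClass c a p → SingletonClass (c ∘ transpose v b) a p
    swap-keeps-SingletonClass p≢v p≢b p-alone =
      subst (SingletonClass (c ∘ transpose v b) _) (transpose-other p≢v p≢b) (SingletonClass-transpose v b p-alone)

    swap-keeps-Swappable : ∀ {v′ b′} → Swappable c v′ b′ →
      v′ ≢ v → v′ ≢ b → b′ ≢ v → b′ ≢ b → c b′ ≢ c b →
      Swappable (c ∘ transpose v b) v′ b′
    swap-keeps-Swappable {v′} {b′} swappable′ v′≢v v′≢b b′≢v b′≢b cb′≢cb = record
      { alone = subst (λ a → SingletonClass (c ∘ transpose v b) a v′) (sym (fixes v′≢v v′≢b))
                  (swap-keeps-SingletonClass v′≢v v′≢b (Swappable.alone swappable′))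
      ; only-neighbour = only-neighbour′
      ; colours-differ = subst₂ _≢_ (sym (fixes v′≢v v′≢b)) (sym (fixes b′≢v b′≢b))
                           (Swappable.colours-differ swappable′)
      }
      where
      fixes : ∀ {u} → u ≢ v → u ≢ b → c (transpose v b u) ≡ c u
      fixes u≢v u≢b = cong c (transpose-other u≢v u≢b)
      only-neighbour′ : ∀ {u} → c (transpose v b u) ≡ c (transpose v b b′) → Adj G v′ u → u ≡ b′
      only-neighbour′ {u} rewrite fixes b′≢v b′≢b with transpose v b u | transposed v b u
      ... | _ | at-i = λ cb≡cb′ _ → contradiction (sym cb≡cb′) cb′≢cb
      ... | _ | at-j = λ cv≡cb′ _ → contradiction (proj₂ alone (sym cv≡cb′)) b′≢v
      ... | _ | elsewhere _ _ = Swappable.only-neighbour swappable′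

  classSize-singleton : ∀ {x} {c : Fin n → Fin x} {a p} → SingletonClass c a p → classSize c a ≡ 1
  classSize-singleton {c = c} {a} (cp≡a , unique) = unique⇒count≡1 (inClass c a) cp≡a unique

  module _ {x} (optimal : NoSmallerColouring x) {c : Fin n → Fin x} (c-bounded : Bounded c) where

    classSize>0 : ∀ j → 0 < classSize c j
    classSize>0 j with any? (inClass c j)
    ... | yes (u , cu≡j) = witness⇒count>0 (inClass c j) cu≡j
    ... | no unused = contradiction (λ u cu≡j → unused (u , cu≡j)) (¬unused-colour optimal c c-bounded j)

    optimal⇒¬Mergeable : ∀ {i j} → ¬ Mergeable c i j
    optimal⇒¬Mergeable {i} {j} mergeable@(i≢j , _) =
      ¬unused-colour optimal (merge i j ∘ c) (merge-bounded c-bounded mergeable) j (λ u → merge≢j (c u) i≢j)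

    singleton-classes-adjacent : 2 ≤ r → ∀ {a a′ p p′} → a ≢ a′ →
      SingletonClass c a p → SingletonClass c a′ p′ → Adj G p p′
    singleton-classes-adjacent 2≤r {a} {a′} {p} {p′} a≢a′ p-alone p′-alone with adj? G p p′
    ... | yes p~p′ = p~p′
    ... | no p≁p′ = contradiction (a≢a′ , sizes≤r , no-edges) optimal⇒¬Mergeable
      where
      sizes≤r : classSize c a + classSize c a′ ≤ r
      sizes≤r = subst₂ (λ s s′ → s + s′ ≤ r)
                  (sym (classSize-singleton p-alone)) (sym (classSize-singleton p′-alone)) 2≤r
      no-edges : ∀ u w → c u ≡ a → c w ≡ a′ → ¬ Adj G u w
      no-edges u w cu≡a cw≡a′ rewrite proj₂ p-alone cu≡a | proj₂ p′-alone cw≡a′ = p≁p′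

module OptimalColouring {n x : ℕ} (G : Graph n) (r : ℕ) (1≤r : 1 ≤ r)
  (optimal : BoundedColourings.NoSmallerColouring G r x)
  (c : Fin n → Fin x) (c-bounded : BoundedColourings.Bounded G r c) where

  open BoundedColourings G r
  open ClassKinds r

  size : Fin x → ℕ
  size = classSize c

  s t : ℕ
  s = singletons size
  t = partials size

  x≡full+s+t : x ≡ full size + s + t
  x≡full+s+t = count-kinds size (classSize>0 optimal c-bounded)

  r*full+s+2t≤n : r * full size + s + 2 * t ≤ n
  r*full+s+2t≤n = subst (r * full size + s + 2 * t ≤_) (∑-fibres c) (weighted-count≤sum size)

  SingletonVertex : Fin n → Set
  SingletonVertex v = IsSingleton (size (c v))

  singletonVertex? : Decidable SingletonVertex
  singletonVertex? v = singleton? (size (c v))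

  singleton⇒2≤r : ∀ {i} → IsSingleton (size i) → 2 ≤ r
  singleton⇒2≤r (size≢r , size≡1) = ≤∧≢⇒< 1≤r (λ 1≡r → size≢r (trans size≡1 1≡r))

  singleton⇒SingletonClass : ∀ {i} → IsSingleton (size i) → ∃ λ p → SingletonClass c i p
  singleton⇒SingletonClass {i} (_ , size≡1) with count>0⇒witness (inClass c i) (≤-reflexive (sym size≡1))
  ... | p , cp≡i = p , cp≡i , λ cu≡i → count≡1⇒unique (inClass c i) size≡1 cu≡i cp≡i

  alone : ∀ {v} → SingletonVertex v → SingletonClass c (c v) v
  alone {v} (_ , size≡1) = refl , λ cu≡cv → count≡1⇒unique (inClass c (c v)) size≡1 cu≡cv refl

  s≤#singletonVertices : s ≤ count singletonVertex?
  s≤#singletonVertices = begin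
    s                                                            ≤⟨ sum-mono member ⟩
    sum (λ i → count (λ u → singletonVertex? u ×-dec c u ≟ᶠ i))  ≡⟨ count-partition singletonVertex? c ⟨
    count singletonVertex?                                       ∎
    where
    open ≤-Reasoning
    member : ∀ i → indicator (singleton? (size i)) ≤ count (λ u → singletonVertex? u ×-dec c u ≟ᶠ i)
    member i = by-cases (singleton? (size i))
      where
      by-cases : (d : Dec (IsSingleton (size i))) →
        indicator d ≤ count (λ u → singletonVertex? u ×-dec c u ≟ᶠ i)
      by-cases (no _) = z≤n
      by-cases (yes sing) with singleton⇒SingletonClass sing
      ... | p , refl , _ = witness⇒count>0 (λ u → singletonVertex? u ×-dec c u ≟ᶠ c p) (sing , refl)

  singleton-colours-differ : ∀ {v u} → SingletonVertex v → u ≢ v → c u ≢ c v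
  singleton-colours-differ v-sing u≢v cu≡cv = u≢v (proj₂ (alone v-sing) cu≡cv)

  singleton-vertices-adjacent : ∀ {u v} → SingletonVertex u → SingletonVertex v → u ≢ v → Adj G u v
  singleton-vertices-adjacent u-sing v-sing u≢v =
    singleton-classes-adjacent optimal c-bounded (singleton⇒2≤r u-sing)
      (singleton-colours-differ v-sing u≢v) (alone u-sing) (alone v-sing)

  neighbourIn? : ∀ v i → Decidable (λ u → Adj G v u × c u ≡ i)
  neighbourIn? v i u = adj? G v u ×-dec c u ≟ᶠ i

  neighboursIn : Fin n → Fin x → ℕ
  neighboursIn v i = count (neighbourIn? v i)

  UniqueNeighbourClass : Fin n → Fin x → Set
  UniqueNeighbourClass v i = IsPartial (size i) × neighboursIn v i ≡ 1

  uniqueNeighbourClass? : ∀ v → Decidable (UniqueNeighbourClass v)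
  uniqueNeighbourClass? v i = partial? (size i) ×-dec neighboursIn v i ≟ⁿ 1

  uniqueNeighbourClasses : Fin n → ℕ
  uniqueNeighbourClasses v = count (uniqueNeighbourClass? v)

  module _ {v} (v-sing : SingletonVertex v) where

    neighboursIn-singleton>0 : ∀ {i} → IsSingleton (size i) → i ≢ c v → 0 < neighboursIn v i
    neighboursIn-singleton>0 {i} i-sing i≢cv with singleton⇒SingletonClass i-sing
    ... | p , cp≡i , p-alone = witness⇒count>0 (neighbourIn? v i) (v~p , cp≡i)
      where
      v~p : Adj G v p
      v~p = singleton-classes-adjacent optimal c-bounded (singleton⇒2≤r v-sing) (i≢cv ∘ sym)
              (alone v-sing) (cp≡i , p-alone)

    neighboursIn-partial>0 : ∀ {i} → IsPartial (size i) → 0 < neighboursIn v i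
    neighboursIn-partial>0 {i} i-part@(size≢r , _) = n≢0⇒n>0 λ nbrs≡0 →
      optimal⇒¬Mergeable optimal c-bounded (cv≢i , sizes≤r , no-edges nbrs≡0)
      where
      cv≢i : c v ≢ i
      cv≢i refl = ¬singleton×partial v-sing i-part
      sizes≤r : size (c v) + size i ≤ r
      sizes≤r = subst (λ k → k + size i ≤ r) (sym (proj₂ v-sing))
                  (≤∧≢⇒< (classSize≤r c-bounded i) size≢r)
      no-edges : neighboursIn v i ≡ 0 → ∀ u w → c u ≡ c v → c w ≡ i → ¬ Adj G u w
      no-edges nbrs≡0 u w cu≡cv cw≡i u~w with proj₂ (alone v-sing) cu≡cv
      ... | refl = count≡0⇒∉ (neighbourIn? v i) nbrs≡0 w (u~w , cw≡i)

    class-contribution : ∀ i →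
      indicator (singleton? (size i)) + 2 * indicator (partial? (size i))
        ≤ neighboursIn v i + indicator (c v ≟ᶠ i) + indicator (uniqueNeighbourClass? v i)
    class-contribution i = by-cases (c v ≟ᶠ i) (singleton? (size i)) (partial? (size i)) (neighboursIn v i ≟ⁿ 1)
      where
      by-cases : (own? : Dec (c v ≡ i)) (sing? : Dec (IsSingleton (size i))) (part? : Dec (IsPartial (size i)))
        (one? : Dec (neighboursIn v i ≡ 1)) →
        indicator sing? + 2 * indicator part? ≤ neighboursIn v i + indicator own? + indicator (part? ×-dec one?)
      by-cases _ (yes sing) (yes part) _ = contradiction part (¬singleton×partial sing)
      by-cases (yes refl) (yes _) (no _) _ = ≤-trans (m≤n+m 1 (neighboursIn v i)) (m≤m+n _ _)
      by-cases (yes refl) (no ¬sing) _ _ = contradiction v-sing ¬sing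
      by-cases (no cv≢i) (yes sing) (no _) _ =
        ≤-trans (neighboursIn-singleton>0 sing (cv≢i ∘ sym)) (≤-trans (m≤m+n _ 0) (m≤m+n _ 0))
      by-cases _ (no _) (no _) _ = z≤n
      by-cases (no _) (no _) (yes part) (yes nbrs≡1) rewrite nbrs≡1 = ≤-refl
      by-cases (no _) (no _) (yes part) (no nbrs≢1) =
        ≤-trans (≤∧≢⇒< (neighboursIn-partial>0 part) (nbrs≢1 ∘ sym)) (≤-trans (m≤m+n _ 0) (m≤m+n _ 0))

    degree-bound : s + 2 * t ≤ degree G v + 1 + uniqueNeighbourClasses v
    degree-bound = begin
      s + 2 * t
        ≡⟨ cong (s +_) (*-distribˡ-sum 2 (indicator ∘ partial? ∘ size)) ⟩
      s + sum (λ i → 2 * indicator (partial? (size i)))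
        ≡⟨ ∑-distrib-+ (indicator ∘ singleton? ∘ size) _ ⟨
      sum (λ i → indicator (singleton? (size i)) + 2 * indicator (partial? (size i)))
        ≤⟨ sum-mono class-contribution ⟩
      sum (λ i → neighboursIn v i + indicator (c v ≟ᶠ i) + indicator (uniqueNeighbourClass? v i))
        ≡⟨ ∑-distrib-+ (λ i → neighboursIn v i + indicator (c v ≟ᶠ i)) _ ⟩
      sum (λ i → neighboursIn v i + indicator (c v ≟ᶠ i)) + uniqueNeighbourClasses v
        ≡⟨ cong (_+ uniqueNeighbourClasses v) (∑-distrib-+ (neighboursIn v) _) ⟩
      sum (neighboursIn v) + count (c v ≟ᶠ_) + uniqueNeighbourClasses v
        ≡⟨ cong₂ (λ d o → d + o + uniqueNeighbourClasses v)
             (trans (sym (count-partition (adj? G v) c)) (sym (degree≡count G v))) (count-≟≡1 (c v)) ⟩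
      degree G v + 1 + uniqueNeighbourClasses v ∎
      where open ≤-Reasoning

  record UniqueNeighbour (v b : Fin n) : Set where
    field
      singleton : SingletonVertex v
      partial   : IsPartial (size (c b))
      adjacent  : Adj G v b
      unique    : ∀ {u} → c u ≡ c b → Adj G v u → u ≡ b

  singleton≢partial : ∀ {u w} → SingletonVertex u → IsPartial (size (c w)) → u ≢ w
  singleton≢partial u-sing w-part refl = ¬singleton×partial u-sing w-part

  UniqueNeighbour⇒Swappable : ∀ {v b} → UniqueNeighbour v b → Swappable c v b
  UniqueNeighbour⇒Swappable N = record
    { alone = alone singleton
    ; only-neighbour = unique
    ; colours-differ = λ cv≡cb → ¬singleton×partial (subst (IsSingleton ∘ size) cv≡cb singleton) partial
    }
    where open UniqueNeighbour N

  record Matching (q : ℕ) : Set where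
    field
      vertex partner   : Fin q → Fin n
      vertex-injective : Injective _≡_ _≡_ vertex
      class-injective  : Injective _≡_ _≡_ (c ∘ partner)
      unique-neighbour : ∀ k → UniqueNeighbour (vertex k) (partner k)

  module _ (p : ℕ) (p≤#singletons : p ≤ count singletonVertex?)
           (p≤uniqueNeighbourClasses : ∀ {v} → SingletonVertex v → p ≤ uniqueNeighbourClasses v) where

    greedy-matching : ∀ q → q ≤ p → Matching q
    greedy-matching zero _ = record
      { vertex = λ () ; partner = λ () ; vertex-injective = λ {} ; class-injective = λ {} ; unique-neighbour = λ () }
    greedy-matching (suc q) q<p
      with greedy-matching q (<⇒≤ q<p)
    ... | M with outside-image singletonVertex? (Matching.vertex M) (≤-trans q<p p≤#singletons)
    ... | v , v-sing , v-new
      with outside-image (uniqueNeighbourClass? v) (c ∘ Matching.partner M)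
             (≤-trans q<p (p≤uniqueNeighbourClasses v-sing))
    ... | B , (B-part , nbrs≡1) , B-new
      with count>0⇒witness (neighbourIn? v B) (≤-reflexive (sym nbrs≡1))
    ... | b , v~b , refl = record
      { vertex = v ∷ vertex
      ; partner = b ∷ partner
      ; vertex-injective = ∷-injective id v-new vertex-injective
      ; class-injective = ∷-injective c B-new class-injective
      ; unique-neighbour = λ
          { zero → record
              { singleton = v-sing ; partial = B-part ; adjacent = v~b
              ; unique = λ cu≡cb v~u →
                  count≡1⇒unique (neighbourIn? v (c b)) nbrs≡1 (v~u , cu≡cb) (v~b , refl) }
          ; (suc k) → unique-neighbour k }
      }
      where open Matching M

  module _ {q} (M : Matching q) where
    open Matching M

    private
      swappable : ∀ k → Swappable c (vertex k) (partner k)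
      swappable k = UniqueNeighbour⇒Swappable (unique-neighbour k)

      singleton≢partner : ∀ {u} k → SingletonVertex u → u ≢ partner k
      singleton≢partner k u-sing = singleton≢partial u-sing (UniqueNeighbour.partial (unique-neighbour k))

    singleton-partner-adjacent : ∀ {u} k → SingletonVertex u → u ≢ partner k → Adj G u (partner k)
    singleton-partner-adjacent {u} k u-sing u≢b with u ≟ᶠ vertex k
    ... | yes refl = UniqueNeighbour.adjacent (unique-neighbour k)
    ... | no u≢v = singleton-classes-adjacent optimal (swap-bounded (swappable k) c-bounded) (singleton⇒2≤r u-sing)
          (singleton-colours-differ (UniqueNeighbour.singleton (unique-neighbour k)) u≢v)
          (swap-keeps-SingletonClass (swappable k) u≢v u≢b (alone u-sing)) (swap-alone (swappable k))

    partners-adjacent : ∀ {k k′} → partner k ≢ partner k′ → Adj G (partner k) (partner k′)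
    partners-adjacent {k} {k′} b≢b′ =
      singleton-classes-adjacent optimal (swap-bounded swappable′ (swap-bounded (swappable k) c-bounded))
        (singleton⇒2≤r v-sing) colours-differ′
        (swap-keeps-SingletonClass swappable′ (v′≢b ∘ sym) b≢b′ (swap-alone (swappable k)))
        (swap-alone swappable′)
      where
      v-sing = UniqueNeighbour.singleton (unique-neighbour k)
      v′-sing = UniqueNeighbour.singleton (unique-neighbour k′)
      k≢k′ : k ≢ k′
      k≢k′ refl = b≢b′ refl
      v′≢b : vertex k′ ≢ partner k
      v′≢b = singleton≢partner k v′-sing
      swappable′ : Swappable (c ∘ transpose (vertex k) (partner k)) (vertex k′) (partner k′)
      swappable′ = swap-keeps-Swappable (swappable k) (swappable k′) (k≢k′ ∘ vertex-injective ∘ sym) v′≢b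
        (singleton≢partner k′ v-sing ∘ sym) (b≢b′ ∘ sym) (k≢k′ ∘ class-injective ∘ sym)
      colours-differ′ : c (vertex k) ≢ c (transpose (vertex k) (partner k) (vertex k′))
      colours-differ′ cv≡ =
        v′≢b (sym (proj₂ (Swappable.alone swappable′) (trans (proj₁ (swap-alone (swappable k))) cv≡)))

    inClique? : Decidable (λ u → SingletonVertex u ⊎ ∃ λ k → partner k ≡ u)
    inClique? u = singletonVertex? u ⊎-dec image? partner u

    clique : IsClique G (tabulate (λ u → ⌊ inClique? u ⌋))
    clique u w u∈ w∈ u≢w with ∈-tabulate⁻ inClique? u∈ | ∈-tabulate⁻ inClique? w∈
    ... | inj₁ u-sing       | inj₁ w-sing       = singleton-vertices-adjacent u-sing w-sing u≢w
    ... | inj₁ u-sing       | inj₂ (k , refl)   = singleton-partner-adjacent k u-sing u≢w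
    ... | inj₂ (k , refl)   | inj₁ w-sing       = Adj-sym G (singleton-partner-adjacent k w-sing (u≢w ∘ sym))
    ... | inj₂ (k , refl)   | inj₂ (k′ , refl)  = partners-adjacent u≢w

    clique-size : count singletonVertex? + q ≤ count inClique?
    clique-size = begin
      count singletonVertex? + q
        ≤⟨ +-monoʳ-≤ _ (injective⇒count-image≥ partner partner-injective) ⟩
      count singletonVertex? + count (image? partner)
        ≡⟨ count-∪ singletonVertex? (image? partner) ⟨
      count inClique? + count (λ u → singletonVertex? u ×-dec image? partner u)
        ≡⟨ cong (count inClique? +_) (∉⇒count≡0 (λ u → singletonVertex? u ×-dec image? partner u)
                                                  disjoint) ⟩
      count inClique? + 0
        ≡⟨ +-identityʳ _ ⟩
      count inClique? ∎
      where
      open ≤-Reasoning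
      partner-injective : Injective _≡_ _≡_ partner
      partner-injective = class-injective ∘ cong c
      disjoint : ∀ u → ¬ (SingletonVertex u × ∃ λ k → partner k ≡ u)
      disjoint u (u-sing , k , refl) = singleton≢partner k u-sing refl

  s+t-dichotomy : ∀ {w} → (∀ K → IsClique G K → ∣ K ∣ ≤ w) →
    2 * (s + t) ≤ w + maxDegree G + 1 ⊎ 2 * s ≤ w
  s+t-dichotomy {w} clique≤w with 2 * (s + t) ≤? w + maxDegree G + 1 | 2 * s ≤? w
  ... | yes small | _ = inj₁ small
  ... | no _ | yes few-singletons = inj₂ few-singletons
  ... | no large | no many-singletons =
    contradiction (clique≤w _ (clique matching)) (<⇒≱ (begin-strict
      w                                    <⟨ m≤n+m∸n (suc w) s ⟩
      s + p                                ≤⟨ +-monoˡ-≤ p s≤#singletonVertices ⟩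
      count singletonVertex? + p           ≤⟨ clique-size matching ⟩
      count (inClique? matching)           ≡⟨ ∣tabulate∣≡count (inClique? matching) ⟨
      ∣ tabulate (λ u → ⌊ inClique? matching u ⌋) ∣ ∎))
    where
    open ≤-Reasoning
    p : ℕ
    p = suc w ∸ s
    p≤uniqueNeighbourClasses : ∀ {v} → SingletonVertex v → p ≤ uniqueNeighbourClasses v
    p≤uniqueNeighbourClasses {v} v-sing = m≤n+o⇒m∸n≤o (suc w) s
      (<-add-cancel w (maxDegree G) s t (uniqueNeighbourClasses v) (≰⇒> large)
        (≤-trans (degree-bound v-sing)
          (+-monoˡ-≤ (uniqueNeighbourClasses v) (+-monoˡ-≤ 1 (degree≤maxDegree G v)))))
    matching : Matching p
    matching = greedy-matching p (≤-trans (m<2n⇒1+m∸n≤n w s (≰⇒> many-singletons)) s≤#singletonVertices)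
                 p≤uniqueNeighbourClasses p ≤-refl

  module _ {m} (full≡m : full size ≡ m) where

    x∸m≡s+t : x ∸ m ≡ s + t
    x∸m≡s+t = begin
      x ∸ m                ≡⟨ cong (_∸ m) x≡full+s+t ⟩
      full size + s + t ∸ m ≡⟨ cong (λ k → k + s + t ∸ m) full≡m ⟩
      m + s + t ∸ m        ≡⟨ cong (_∸ m) (+-assoc m s t) ⟩
      m + (s + t) ∸ m      ≡⟨ m+n∸m≡n m (s + t) ⟩
      s + t                ∎
      where open ≡-Reasoning

    s+2t≤n∸rm : s + 2 * t ≤ n ∸ r * m
    s+2t≤n∸rm = m+n≤o⇒m≤o∸n (s + 2 * t) (subst (_≤ n) reorder r*full+s+2t≤n)
      where
      reorder : r * full size + s + 2 * t ≡ s + 2 * t + r * m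
      reorder = trans (cong (λ k → r * k + s + 2 * t) full≡m)
                  (trans (+-assoc (r * m) s (2 * t)) (+-comm (r * m) (s + 2 * t)))

  fullClasses≡full : fullClasses c r ≡ full size
  fullClasses≡full = trans (∣tabulate∣≡count (λ i → ∣ colourClass c i ∣ ≟ⁿ r))
    (count-cong (λ i → ∣ colourClass c i ∣ ≟ⁿ r) (λ i → size i ≟ⁿ r)
      (λ {i} → subst (_≡ r) (∣colourClass∣≡size i))
      (λ {i} → subst (_≡ r) (sym (∣colourClass∣≡size i))))
    where
    ∣colourClass∣≡size : ∀ i → ∣ colourClass c i ∣ ≡ size i
    ∣colourClass∣≡size i = ∣tabulate∣≡count (inClass c i)

theorem6p14 : ∀ {n} (G : Graph n) (r : ℕ) → 1 ≤ r →
    ∀ x m w → IsChiR G r x → IsMR G r x m → IsCliqueNumber G w →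
    (2 * (x ∸ m) ≤ w + maxDegree G + 1)
    ⊎ (4 * (x ∸ m) ≤ w + 2 * (order G ∸ r * m))
theorem6p14 {n} G r 1≤r x m w (_ , optimal) ((c , c-bounded , c-full) , _) (_ , clique≤w) =
  Sum.map (subst (λ k → 2 * k ≤ w + maxDegree G + 1) (sym (x∸m≡s+t full≡m))) few-singletons
    (s+t-dichotomy clique≤w)
  where
  open OptimalColouring G r 1≤r optimal c c-bounded
  full≡m : ClassKinds.full r size ≡ m
  full≡m = trans (sym fullClasses≡full) c-full
  few-singletons : 2 * s ≤ w → 4 * (x ∸ m) ≤ w + 2 * (n ∸ r * m)
  few-singletons 2s≤w = begin
    4 * (x ∸ m)             ≡⟨ cong (4 *_) (x∸m≡s+t full≡m) ⟩
    4 * (s + t)             ≡⟨ regroup s t ⟩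
    2 * s + 2 * (s + 2 * t) ≤⟨ +-mono-≤ 2s≤w (*-monoʳ-≤ 2 (s+2t≤n∸rm full≡m)) ⟩
    w + 2 * (n ∸ r * m)     ∎
    where
    open ≤-Reasoning
    regroup : ∀ a b → 4 * (a + b) ≡ 2 * a + 2 * (a + 2 * b)
    regroup = solve-∀
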